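{- Let $n\ge3$ be an integer, ${\mathrm T}_m=\binom{m+1}{2}$, and ${\mathcal T}_n=\langle {\mathrm T}_n,{\mathrm T}_{n+1},{\mathrm T}_{n+2}\rangle$. Then: (1) if $n$ is odd, $\mathrm{Ap}({\mathcal T}_n,{\mathrm T}_n)=\{a{\mathrm T}_{n+1}+b{\mathrm T}_{n+2} \mid a\in\{0,\ldots,n-1\},\ b\in\{0,\ldots,\frac{n-1}{2}\}\}$; (2) if $n$ is even, $\mathrm{Ap}({\mathcal T}_n,{\mathrm T}_n)=\{a{\mathrm T}_{n+1}+b{\mathrm T}_{n+2} \mid a\in\{0,\ldots,\frac{n-2}{2}\},\ b\in\{0,\ldots,n\}\}$.
   Context: For a numerical semigroup $S$ and $m\in S\setminus\{0\}$, the Apéry set of $m$ in $S$ is $\mathrm{Ap}(S,m)=\{s\in S \mid s-m\notin S\}$. -}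

module Defs where

open import Data.Nat using (ℕ; _+_; _*_; _∸_; _≤_)
open import Data.Nat.Combinatorics using (_C_)
open import Data.Product using (∃-syntax; _×_)
open import Relation.Binary.PropositionalEquality using (_≡_)
open import Relation.Nullary using (¬_)

T : ℕ → ℕ
T m = (m + 1) C 2

InSG3 : ℕ → ℕ → ℕ → ℕ → Set
InSG3 g₁ g₂ g₃ s = ∃[ x ] ∃[ y ] ∃[ z ] (s ≡ x * g₁ + y * g₂ + z * g₃)

InTn : ℕ → ℕ → Set
InTn n = InSG3 (T n) (T (n + 1)) (T (n + 2))

-- Apéry set membership: s ∈ Ap(𝒯_n, T_n) iff s ∈ 𝒯_n and s - T_n ∉ 𝒯_n
-- (s - T_n ∉ S  includes the case s < T_n, where s - T_n is negative)
InApery : ℕ → ℕ → Set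
InApery n s = InTn n s × ¬ (T n ≤ s × InTn n (s ∸ T n))

{-# OPTIONS --safe #-}
module Submission where

-- Write Q = k + 1, q = n, U = n + 2 when n = 2k + 1 and Q = n + 1, q = k + 1,
-- U = k + 2 when n = 2k + 2. Then T_n = qQ, T_{n+1} = UQ, T_{n+2} = VQ + 1 for
-- some V, and q, U are coprime. The relations q T_{n+1} = U T_n and
-- B T_{n+2} = C T_{n+1} (with B = Q) rewrite every element of 𝒯_n as
-- c T_n + a T_{n+1} + b T_{n+2} with a < q and b < B, so the Apéry set lies in
-- this box. Conversely an equality
--   a T_{n+1} + b T_{n+2} = (c + 1) T_n + a' T_{n+1} + b' T_{n+2}
-- inside the box forces b = b' (compare remainders mod Q), and then
-- (a − a') U = (c + 1) q, impossible since q ∣ a − a' while 0 < a − a' < q.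

open import Defs
open import Data.Nat using (ℕ; zero; suc; _+_; _*_; _∸_; _≤_; _<_; _≤?_; z≤n; s≤s; NonZero; >-nonZero; _%_; _/_)
open import Data.Nat.Properties
open import Data.Nat.DivMod using (m≡m%n+[m/n]*n; m%n<n; m<n⇒m%n≡m; [m+kn]%n≡m%n)
open import Data.Nat.Divisibility using (divides; >⇒∤)
open import Data.Nat.Coprimality using (Coprime; Bézout-coprime; coprime-divisor)
open import Data.Nat.GCD using (module Bézout)
open import Data.Nat.Combinatorics using (_C_; nCk+nC[k+1]≡[n+1]C[k+1]; nC1≡n)
open import Data.Nat.Tactic.RingSolver using (solve)
open import Data.List using (_∷_; [])
open import Data.Product using (∃-syntax; _×_; _,_; proj₁; proj₂)
open import Relation.Binary.PropositionalEquality using (_≡_; _≢_; refl; sym; trans; cong; subst; subst₂; module ≡-Reasoning)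
open import Relation.Nullary using (¬_; yes; no)
open import Data.Empty using (⊥-elim)
open import Function.Bundles using (_⇔_; mk⇔)
open import Function.Properties.Equivalence using () renaming (trans to ⇔-trans)

open ≡-Reasoning

remainder-quotient-unique : ∀ {Q} .{{_ : NonZero Q}} {r r′ x y} → r < Q → r′ < Q →
                            r + x * Q ≡ r′ + y * Q → r ≡ r′ × x ≡ y
remainder-quotient-unique {Q} {r} {r′} {x} {y} r<Q r′<Q eq =
  r≡r′ , *-cancelʳ-≡ x y Q (+-cancelˡ-≡ r _ _ (trans eq (cong (_+ y * Q) (sym r≡r′))))
  where
  r≡r′ : r ≡ r′
  r≡r′ = begin
    r                ≡⟨ sym (m<n⇒m%n≡m r<Q) ⟩
    r % Q            ≡⟨ sym ([m+kn]%n≡m%n r x Q) ⟩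
    (r + x * Q) % Q  ≡⟨ cong (_% Q) eq ⟩
    (r′ + y * Q) % Q ≡⟨ [m+kn]%n≡m%n r′ y Q ⟩
    r′ % Q           ≡⟨ m<n⇒m%n≡m r′<Q ⟩
    r′               ∎

Bézout⇒coprime : ∀ {m n} x y → 1 + x * m ≡ y * n → Coprime m n
Bézout⇒coprime {m} {n} x y eq = Bézout-coprime {d = 1} (Bézout.-+ x y
  (subst₂ (λ m′ n′ → 1 + x * m′ ≡ y * n′) (sym (*-identityʳ m)) (sym (*-identityʳ n)) eq))

coprime⇒a*u≢[1+c]*q+a′*u : ∀ {q u a a′ c} → Coprime q u → a < q → a′ < q →
                            a * u ≢ suc c * q + a′ * u
coprime⇒a*u≢[1+c]*q+a′*u {q} {u} {a} {a′} {c} q⊥u a<q a′<q eq with a ≤? a′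
... | yes a≤a′ = <⇒≱ (m<n+m (a′ * u) 0<[1+c]*q) (subst₂ _≤_ eq refl (*-monoˡ-≤ u a≤a′))
  where
  0<[1+c]*q : 0 < suc c * q
  0<[1+c]*q = <-≤-trans (≤-<-trans z≤n a<q) (m≤m+n q (c * q))
... | no a≰a′ with m≤n⇒∃[o]m+o≡n (≰⇒> a≰a′)
... | d , refl = >⇒∤ [1+d]<q (coprime-divisor q⊥u (divides (suc c) u*[1+d]≡[1+c]*q))
  where
  [1+d]<q : suc d < q
  [1+d]<q = ≤-<-trans (subst (suc d ≤_) (+-suc a′ d) (m≤n+m (suc d) a′)) a<q
  u*[1+d]≡[1+c]*q : u * suc d ≡ suc c * q
  u*[1+d]≡[1+c]*q = trans (*-comm u (suc d)) (+-cancelˡ-≡ (a′ * u) _ _ (begin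
    a′ * u + suc d * u  ≡⟨ solve (a′ ∷ d ∷ u ∷ []) ⟩
    (suc a′ + d) * u    ≡⟨ eq ⟩
    suc c * q + a′ * u  ≡⟨ +-comm (suc c * q) (a′ * u) ⟩
    a′ * u + suc c * q  ∎))

split-by-relation : ∀ m {N w K w′} .{{_ : NonZero N}} → N * w ≡ K * w′ →
                    m * w ≡ m % N * w + m / N * K * w′
split-by-relation m {N} {w} {K} {w′} Nw≡Kw′ = begin
  m * w                        ≡⟨ cong (_* w) (m≡m%n+[m/n]*n m N) ⟩
  (m % N + m / N * N) * w      ≡⟨ *-distribʳ-+ w (m % N) (m / N * N) ⟩
  m % N * w + m / N * N * w    ≡⟨ cong (m % N * w +_) (*-assoc (m / N) N w) ⟩
  m % N * w + m / N * (N * w)  ≡⟨ cong (λ x → m % N * w + m / N * x) Nw≡Kw′ ⟩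
  m % N * w + m / N * (K * w′) ≡⟨ cong (m % N * w +_) (sym (*-assoc (m / N) K w′)) ⟩
  m % N * w + m / N * K * w′   ∎

carry : ∀ {u v B C} .{{_ : NonZero B}} → B * v ≡ C * u → ∀ y z →
        y * u + z * v ≡ (y + z / B * C) * u + z % B * v
carry {u} {v} {B} {C} Bv≡Cu y z = begin
  y * u + z * v                          ≡⟨ cong (y * u +_) (split-by-relation z Bv≡Cu) ⟩
  y * u + (z % B * v + z / B * C * u)    ≡⟨ rearrange y u (z % B) v (z / B * C) ⟩
  (y + z / B * C) * u + z % B * v        ∎
  where
  rearrange : ∀ y u b v e → y * u + (b * v + e * u) ≡ (y + e) * u + b * v
  rearrange y u b v e = solve (y ∷ u ∷ b ∷ v ∷ e ∷ [])

reduce-to-box : ∀ {t u v A B C D} .{{_ : NonZero A}} .{{_ : NonZero B}} →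
                A * u ≡ D * t → B * v ≡ C * u → ∀ x y z →
                ∃[ c ] ∃[ a ] ∃[ b ] (a < A × b < B × x * t + y * u + z * v ≡ c * t + a * u + b * v)
reduce-to-box {t} {u} {v} {A} {B} {C} {D} Au≡Dt Bv≡Cu x y z =
  x + y′ / A * D , y′ % A , z % B , m%n<n y′ A , m%n<n z B , (begin
    x * t + y * u + z * v                          ≡⟨ +-assoc (x * t) (y * u) (z * v) ⟩
    x * t + (y * u + z * v)                        ≡⟨ cong (x * t +_) (carry Bv≡Cu y z) ⟩
    x * t + (y′ * u + z % B * v)                   ≡⟨ sym (+-assoc (x * t) (y′ * u) (z % B * v)) ⟩
    x * t + y′ * u + z % B * v                     ≡⟨ cong (_+ z % B * v) (carry Au≡Dt x y′) ⟩
    (x + y′ / A * D) * t + y′ % A * u + z % B * v  ∎)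
  where
  y′ : ℕ
  y′ = y + z / B * C

decomposed-shift-free : ∀ {q U V Q B a b a′ b′ c} .{{_ : NonZero Q}} → Coprime q U → B ≤ Q →
                        a < q → b < B → a′ < q → b′ < B →
                        a * (U * Q) + b * (V * Q + 1) ≢ suc c * (q * Q) + a′ * (U * Q) + b′ * (V * Q + 1)
decomposed-shift-free {q} {U} {V} {Q} {B} {a} {b} {a′} {b′} {c} q⊥U B≤Q a<q b<B a′<q b′<B eq =
  coprime⇒a*u≢[1+c]*q+a′*u {c = c} q⊥U a<q a′<q (+-cancelʳ-≡ (b * V) _ _ (begin
    a * U + b * V                ≡⟨ quotients-equal ⟩
    suc c * q + a′ * U + b′ * V  ≡⟨ cong (λ x → suc c * q + a′ * U + x * V) (sym b≡b′) ⟩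
    suc c * q + a′ * U + b * V   ∎))
  where
  digits : b + (a * U + b * V) * Q ≡ b′ + (suc c * q + a′ * U + b′ * V) * Q
  digits = begin
    b + (a * U + b * V) * Q                             ≡⟨ solve (b ∷ a ∷ U ∷ V ∷ Q ∷ []) ⟩
    a * (U * Q) + b * (V * Q + 1)                       ≡⟨ eq ⟩
    suc c * (q * Q) + a′ * (U * Q) + b′ * (V * Q + 1)   ≡⟨ solve (c ∷ q ∷ Q ∷ a′ ∷ U ∷ b′ ∷ V ∷ []) ⟩
    b′ + (suc c * q + a′ * U + b′ * V) * Q              ∎
  remainders-and-quotients-equal : b ≡ b′ × a * U + b * V ≡ suc c * q + a′ * U + b′ * V
  remainders-and-quotients-equal = remainder-quotient-unique (<-≤-trans b<B B≤Q) (<-≤-trans b′<B B≤Q) digits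
  b≡b′ : b ≡ b′
  b≡b′ = proj₁ remainders-and-quotients-equal
  quotients-equal : a * U + b * V ≡ suc c * q + a′ * U + b′ * V
  quotients-equal = proj₂ remainders-and-quotients-equal

module DecomposedGenerators
  (t u v q U V Q B C : ℕ) .{{_ : NonZero q}} .{{_ : NonZero Q}} .{{_ : NonZero B}}
  (t≡q*Q : t ≡ q * Q) (u≡U*Q : u ≡ U * Q) (v≡V*Q+1 : v ≡ V * Q + 1)
  (q⊥U : Coprime q U) (B≤Q : B ≤ Q) (B*[V*Q+1]≡C*[U*Q] : B * (V * Q + 1) ≡ C * (U * Q))
  where

  InBox : ℕ → Set
  InBox s = ∃[ a ] ∃[ b ] (a < q × b < B × s ≡ a * u + b * v)

  private
    q*u≡U*t : q * u ≡ U * t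
    q*u≡U*t rewrite t≡q*Q | u≡U*Q = solve (q ∷ U ∷ Q ∷ [])

    B*v≡C*u : B * v ≡ C * u
    B*v≡C*u rewrite u≡U*Q | v≡V*Q+1 = B*[V*Q+1]≡C*[U*Q]

    shift-free : ∀ {a b a′ b′ c} → a < q → b < B → a′ < q → b′ < B →
                 a * u + b * v ≢ suc c * t + a′ * u + b′ * v
    shift-free {c = c} rewrite t≡q*Q | u≡U*Q | v≡V*Q+1 = decomposed-shift-free {V = V} {c = c} q⊥U B≤Q

    absorb-t : ∀ c a b → t + (c * t + a * u + b * v) ≡ suc c * t + a * u + b * v
    absorb-t c a b = solve (t ∷ c ∷ a ∷ u ∷ b ∷ v ∷ [])

  apery⇔box : ∀ s → (InSG3 t u v s × ¬ (t ≤ s × InSG3 t u v (s ∸ t))) ⇔ InBox s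
  apery⇔box s = mk⇔ to from
    where
    reduce : ∀ x y z → ∃[ c ] ∃[ a ] ∃[ b ] (a < q × b < B × x * t + y * u + z * v ≡ c * t + a * u + b * v)
    reduce = reduce-to-box {A = q} {B = B} {C = C} {D = U} q*u≡U*t B*v≡C*u
    to : InSG3 t u v s × ¬ (t ≤ s × InSG3 t u v (s ∸ t)) → InBox s
    to ((x , y , z , s≡) , s∉t+S) with reduce x y z
    ... | zero  , a , b , a<q , b<B , eq = a , b , a<q , b<B , trans s≡ eq
    ... | suc c , a , b , a<q , b<B , eq =
      ⊥-elim (s∉t+S (subst (t ≤_) (sym s≡t+w) (m≤m+n t _) , c , a , b , s∸t≡w))
      where
      s≡t+w : s ≡ t + (c * t + a * u + b * v)
      s≡t+w = trans s≡ (trans eq (sym (absorb-t c a b)))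
      s∸t≡w : s ∸ t ≡ c * t + a * u + b * v
      s∸t≡w = trans (cong (_∸ t) s≡t+w) (m+n∸m≡n t _)
    from : InBox s → InSG3 t u v s × ¬ (t ≤ s × InSG3 t u v (s ∸ t))
    from (a , b , a<q , b<B , s≡) = (0 , a , b , s≡) , s∉t+S
      where
      s∉t+S : ¬ (t ≤ s × InSG3 t u v (s ∸ t))
      s∉t+S (t≤s , x , y , z , s∸t≡) with reduce x y z
      ... | c , a′ , b′ , a′<q , b′<B , eq = shift-free {c = c} a<q b<B a′<q b′<B (begin
        a * u + b * v                    ≡⟨ sym s≡ ⟩
        s                                ≡⟨ sym (m+[n∸m]≡n t≤s) ⟩
        t + (s ∸ t)                      ≡⟨ cong (t +_) (trans s∸t≡ eq) ⟩
        t + (c * t + a′ * u + b′ * v)    ≡⟨ absorb-t c a′ b′ ⟩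
        suc c * t + a′ * u + b′ * v      ∎)

T-suc : ∀ m → T (suc m) ≡ T m + suc m
T-suc m = begin
  T (suc m)          ≡⟨ sym (nCk+nC[k+1]≡[n+1]C[k+1] (m + 1) 1) ⟩
  (m + 1) C 1 + T m  ≡⟨ cong (_+ T m) (nC1≡n (m + 1)) ⟩
  m + 1 + T m        ≡⟨ +-comm (m + 1) (T m) ⟩
  T m + (m + 1)      ≡⟨ cong (T m +_) (+-comm m 1) ⟩
  T m + suc m        ∎

2*T≡m*[1+m] : ∀ m → 2 * T m ≡ m * suc m
2*T≡m*[1+m] zero    = refl
2*T≡m*[1+m] (suc m) = begin
  2 * T (suc m)          ≡⟨ cong (2 *_) (T-suc m) ⟩
  2 * (T m + suc m)      ≡⟨ *-distribˡ-+ 2 (T m) (suc m) ⟩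
  2 * T m + 2 * suc m    ≡⟨ cong (_+ 2 * suc m) (2*T≡m*[1+m] m) ⟩
  m * suc m + 2 * suc m  ≡⟨ solve (m ∷ []) ⟩
  suc m * suc (suc m)    ∎

m*[1+m]≡2*y⇒T≡y : ∀ m y → m * suc m ≡ 2 * y → T m ≡ y
m*[1+m]≡2*y⇒T≡y m y eq = *-cancelˡ-≡ (T m) y 2 (trans (2*T≡m*[1+m] m) eq)

apery-odd : ∀ k s → InApery (2 * k + 1) s ⇔
            (∃[ a ] ∃[ b ] (a < 2 * k + 1 × b ≤ k × s ≡ a * T (2 * k + 1 + 1) + b * T (2 * k + 1 + 2)))
apery-odd k s = ⇔-trans (apery⇔box s) (mk⇔
  (λ { (a , b , a<n , s≤s b≤k , s≡) → a , b , a<n , b≤k , s≡ })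
  (λ { (a , b , a<n , b≤k , s≡) → a , b , a<n , s≤s b≤k , s≡ }))
  where
  instance
    2k+1≢0 : NonZero (2 * k + 1)
    2k+1≢0 = >-nonZero (m≤n+m 1 (2 * k))
  open DecomposedGenerators
    (T (2 * k + 1)) (T (2 * k + 1 + 1)) (T (2 * k + 1 + 2))
    (2 * k + 1) (2 * k + 3) (2 * k + 5) (suc k) (suc k) (k + 2)
    (m*[1+m]≡2*y⇒T≡y (2 * k + 1) ((2 * k + 1) * suc k) (solve (k ∷ [])))
    (m*[1+m]≡2*y⇒T≡y (2 * k + 1 + 1) ((2 * k + 3) * suc k) (solve (k ∷ [])))
    (m*[1+m]≡2*y⇒T≡y (2 * k + 1 + 2) ((2 * k + 5) * suc k + 1) (solve (k ∷ [])))
    (Bézout⇒coprime {2 * k + 1} {2 * k + 3} (k + 2) (k + 1) (solve (k ∷ [])))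
    ≤-refl
    (solve (k ∷ []))

apery-even : ∀ k s → InApery (2 * k + 2) s ⇔
             (∃[ a ] ∃[ b ] (a ≤ k × b ≤ 2 * k + 2 × s ≡ a * T (2 * k + 2 + 1) + b * T (2 * k + 2 + 2)))
apery-even k s = ⇔-trans (apery⇔box s) (mk⇔
  (λ { (a , b , s≤s a≤k , s≤s b≤n , s≡) → a , b , a≤k , b≤n , s≡ })
  (λ { (a , b , a≤k , b≤n , s≡) → a , b , s≤s a≤k , s≤s b≤n , s≡ }))
  where
  open DecomposedGenerators
    (T (2 * k + 2)) (T (2 * k + 2 + 1)) (T (2 * k + 2 + 2))
    (suc k) (k + 2) (k + 3) (suc (2 * k + 2)) (suc (2 * k + 2)) (2 * k + 5)
    (m*[1+m]≡2*y⇒T≡y (2 * k + 2) (suc k * suc (2 * k + 2)) (solve (k ∷ [])))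
    (m*[1+m]≡2*y⇒T≡y (2 * k + 2 + 1) ((k + 2) * suc (2 * k + 2)) (solve (k ∷ [])))
    (m*[1+m]≡2*y⇒T≡y (2 * k + 2 + 2) ((k + 3) * suc (2 * k + 2) + 1) (solve (k ∷ [])))
    (Bézout⇒coprime {suc k} {k + 2} 1 1 (solve (k ∷ [])))
    ≤-refl
    (solve (k ∷ []))

-- The bound 3 ≤ n is not needed: the description also holds for n = 1 and n = 2.
corollary28 : (n : ℕ) → 3 ≤ n →
    ((k : ℕ) → n ≡ 2 * k + 1 → (s : ℕ) →
      InApery n s ⇔ (∃[ a ] ∃[ b ] (a < n × b ≤ k × s ≡ a * T (n + 1) + b * T (n + 2))))
    × ((k : ℕ) → n ≡ 2 * k + 2 → (s : ℕ) →
      InApery n s ⇔ (∃[ a ] ∃[ b ] (a ≤ k × b ≤ n × s ≡ a * T (n + 1) + b * T (n + 2))))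
corollary28 n _ = (λ { k refl → apery-odd k }) , (λ { k refl → apery-even k })
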